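{- Let $m \ge 5$ with $m \equiv 2 \pmod 3$, and let $n \ge 6$ with $n \equiv 0 \pmod 6$. Write $m = 3k+2$. Then $\gamma_{r2}(C_{m} \Box C_n) \leq kn + n$.
   Context: A 2-rainbow dominating function (2RDF) of a graph $G$ assigns to each vertex a subset of $\{1,2\}$ so that every vertex $v$ with $f(v)=\emptyset$ satisfies $\bigcup_{u\in N(v)} f(u)=\{1,2\}$; its weight is $\sum_v |f(v)|$ and $\gamma_{r2}(G)$ is the minimum weight of a 2RDF of $G$. $C_m \Box C_n$ is the Cartesian product of the cycles $C_m$ and $C_n$. -}

module Defs where

open import Data.Nat using (ℕ; zero; suc; _+_; _*_; _≤_)
open import Data.Nat.DivMod using (_%_)
open import Data.Fin using (Fin; toℕ)
open import Data.Bool using (Bool; true; false)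
open import Data.List using (List; map; allFin)
open import Data.Nat.ListAction using (sum)
open import Data.List.Relation.Unary.Any using (Any)
open import Data.Product using (_×_; Σ; ∃; _,_)
open import Data.Sum using (_⊎_)
open import Relation.Binary.PropositionalEquality using (_≡_)

CycleAdj : (m : ℕ) → Fin m → Fin m → Set
CycleAdj zero ()
CycleAdj (suc m) i j =
  (toℕ j ≡ suc (toℕ i) % suc m) ⊎ (toℕ i ≡ suc (toℕ j) % suc m)

TorusAdj : (m n : ℕ) → Fin m × Fin n → Fin m × Fin n → Set
TorusAdj m n (i , j) (i' , j') =
  (i ≡ i' × CycleAdj n j j') ⊎ (j ≡ j' × CycleAdj m i i')

-- A subset of {1,2}, encoded by its characteristic pair (1 ∈ S, 2 ∈ S).
Label : Set
Label = Bool × Bool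

∣_∣ₗ : Label → ℕ
∣ (a , b) ∣ₗ = bit a + bit b
  where
  bit : Bool → ℕ
  bit true = 1
  bit false = 0

IsEmpty : Label → Set
IsEmpty (a , b) = (a ≡ false) × (b ≡ false)

Is2RDF : (m n : ℕ) → (Fin m × Fin n → Label) → Set
Is2RDF m n f = ∀ v → IsEmpty (f v) →
  (∃ λ u → TorusAdj m n v u × Data.Product.proj₁ (f u) ≡ true) ×
  (∃ λ u → TorusAdj m n v u × Data.Product.proj₂ (f u) ≡ true)

weight : (m n : ℕ) → (Fin m × Fin n → Label) → ℕ
weight m n f = sum (map (λ i → sum (map (λ j → ∣ f (i , j) ∣ₗ) (allFin n))) (allFin m))

-- γ_{r2}(C_m □ C_n) ≤ B : some 2RDF has weight at most B
-- (equivalent to the minimum weight being ≤ B).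
γr2≤ : (m n B : ℕ) → Set
γr2≤ m n B = ∃ λ f → Is2RDF m n f × weight m n f ≤ B

-- Columns are tiled 6-periodically. Row type rₚ (p = 0, 1, 2) puts 1 in column 2p and 2 in
-- column 2p + 3 (mod 6), so it has weight n/3, and every empty cell of rₚ sees one colour in
-- its own row and the other in rₚ₋₁ or rₚ₊₁. For m = 3k + 2 the rows are (r₀ r₁ r₂)ᵏ r₀ r₁₂,
-- where r₁₂ carries the labels of r₁ and r₂ together: it stands in for the two missing rows,
-- and r₀ is still dominated with r₁₂ as a neighbour. The weight is (3k + 1)·n/3 + 2n/3 = (k + 1)n.
-- Since the labelling factors through closed walks in the digraph of row types and in C₆,
-- domination reduces to a finite check on the tile.

{-# OPTIONS --safe #-}
module Submission where

open import Defs
open import Data.Nat using (ℕ; zero; suc; _+_; _*_; _≤_; _<_; _<?_; s<s; s<s⁻¹)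
open import Data.Nat.DivMod using (_%_; m%n<n; n%n≡0; m<n⇒m%n≡m)
open import Data.Nat.Divisibility using (divides; m%n≡0⇒n∣m)
open import Data.Nat.Properties
  using (≤-antisym; ≮⇒≥; ≤-reflexive; +-comm; +-assoc; *-distribˡ-+; *-zeroʳ; *-suc; +-suc; suc-injective; *-commutativeSemigroup)
open import Algebra.Properties.CommutativeSemigroup *-commutativeSemigroup using (x∙yz≈y∙xz)
open import Data.Fin using (Fin; zero; suc; toℕ; fromℕ; fromℕ<; inject₁)
open import Data.Fin.Properties using (toℕ<n; toℕ-fromℕ; toℕ-fromℕ<; toℕ-inject₁)
open import Data.Bool using (Bool; true; false)
open import Data.List using (List; []; _∷_; map; allFin; tabulate)
open import Data.List.Properties using (map-tabulate; map-cong)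
open import Data.Nat.ListAction using (sum)
open import Data.List.Relation.Unary.All using (All; []; _∷_; lookupAny)
open import Data.List.Relation.Unary.Any as Any using (Any; here; there)
open import Data.List.Relation.Unary.Any.Properties using (map⁻)
open import Data.Product using (_×_; ∃; _,_; proj₁; proj₂)
open import Data.Sum using (inj₁; inj₂)
open import Function using (_∘_)
open import Relation.Nullary using (yes; no)
open import Relation.Binary.PropositionalEquality
  using (_≡_; refl; sym; trans; cong; cong₂; subst; subst₂; module ≡-Reasoning)

CycleSucc : (m : ℕ) → Fin m → Fin m → Set
CycleSucc (suc m) i j = toℕ j ≡ suc (toℕ i) % suc m

cycleSucc-adj : ∀ {m} {i j : Fin m} → CycleSucc m i j → CycleAdj m i j
cycleSucc-adj {suc m} s = inj₁ s

cyclePred-adj : ∀ {m} {i j : Fin m} → CycleSucc m j i → CycleAdj m i j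
cyclePred-adj {suc m} s = inj₂ s

cycleSuccessor : ∀ {m} (i : Fin m) → ∃ (CycleSucc m i)
cycleSuccessor {suc m} i = fromℕ< (m%n<n (suc (toℕ i)) (suc m)) , toℕ-fromℕ< _

cyclePredecessor : ∀ {m} (i : Fin m) → ∃ λ j → CycleSucc m j i
cyclePredecessor {suc m} zero =
  fromℕ m , sym (trans (cong (λ a → suc a % suc m) (toℕ-fromℕ m)) (n%n≡0 (suc m)))
cyclePredecessor {suc m} (suc i) =
  inject₁ i , sym (trans (cong (λ a → suc a % suc m) (toℕ-inject₁ i)) (m<n⇒m%n≡m (s<s (toℕ<n i))))

record ClosedWalk {R : Set} (_⇒_ : R → R → Set) (m : ℕ) (ρ : ℕ → R) : Set where
  field
    step : ∀ a → suc a < m → ρ a ⇒ ρ (suc a)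
    wrap : ∀ a → suc a ≡ m → ρ a ⇒ ρ 0

closedWalk-hom : ∀ {R : Set} {_⇒_ : R → R → Set} {m} {ρ : ℕ → R} → ClosedWalk _⇒_ m ρ →
  ∀ {i j : Fin m} → CycleSucc m i j → ρ (toℕ i) ⇒ ρ (toℕ j)
closedWalk-hom {_⇒_ = _⇒_} {suc m} {ρ} walk {i} {j} j≡i+1 with suc (toℕ i) <? suc m
... | yes i+1<m =
  subst (λ a → ρ (toℕ i) ⇒ ρ a) (sym (trans j≡i+1 (m<n⇒m%n≡m i+1<m))) (ClosedWalk.step walk (toℕ i) i+1<m)
... | no i+1≮m = subst (λ a → ρ (toℕ i) ⇒ ρ a) (sym j≡0) (ClosedWalk.wrap walk (toℕ i) i+1≡m)
  where
  i+1≡m : suc (toℕ i) ≡ suc m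
  i+1≡m = ≤-antisym (toℕ<n i) (≮⇒≥ i+1≮m)
  j≡0 : toℕ j ≡ 0
  j≡0 = trans j≡i+1 (trans (cong (_% suc m) i+1≡m) (n%n≡0 (suc m)))

Sees : (Label → Bool) → List Label → Set
Sees π = Any (λ ℓ → π ℓ ≡ true)

Rainbow : List Label → Set
Rainbow ℓs = Sees proj₁ ℓs × Sees proj₂ ℓs

module _ {R C : Set} (_⟶_ : R → R → Set) (prev next : C → C) (tile : R → C → Label) where

  LocallyRainbow : Set
  LocallyRainbow = ∀ r c → IsEmpty (tile r c) → ∀ {r⁻ r⁺} → r⁻ ⟶ r → r ⟶ r⁺ →
    Rainbow (tile r⁻ c ∷ tile r⁺ c ∷ tile r (prev c) ∷ tile r (next c) ∷ [])

  pullback-2RDF : LocallyRainbow → (∀ c → prev (next c) ≡ c) →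
    ∀ {m n} (ρ : ℕ → R) (γ : ℕ → C) → ClosedWalk _⟶_ m ρ → ClosedWalk (λ c c' → c' ≡ next c) n γ →
    Is2RDF m n (λ (i , j) → tile (ρ (toℕ i)) (γ (toℕ j)))
  pullback-2RDF rainbow prev-next {m} {n} ρ γ ρ-walk γ-walk (i , j) empty =
    neighbour proj₁ (proj₁ seen) , neighbour proj₂ (proj₂ seen)
    where
    f : Fin m × Fin n → Label
    f (i , j) = tile (ρ (toℕ i)) (γ (toℕ j))

    i⁻ i⁺ : Fin m
    i⁻ = proj₁ (cyclePredecessor i)
    i⁺ = proj₁ (cycleSuccessor i)
    j⁻ j⁺ : Fin n
    j⁻ = proj₁ (cyclePredecessor j)
    j⁺ = proj₁ (cycleSuccessor j)

    neighbours : List (Fin m × Fin n)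
    neighbours = (i⁻ , j) ∷ (i⁺ , j) ∷ (i , j⁻) ∷ (i , j⁺) ∷ []

    adjacent : All (TorusAdj m n (i , j)) neighbours
    adjacent = inj₂ (refl , cyclePred-adj (proj₂ (cyclePredecessor i)))
             ∷ inj₂ (refl , cycleSucc-adj (proj₂ (cycleSuccessor i)))
             ∷ inj₁ (refl , cyclePred-adj (proj₂ (cyclePredecessor j)))
             ∷ inj₁ (refl , cycleSucc-adj (proj₂ (cycleSuccessor j)))
             ∷ []

    γ⁺ : γ (toℕ j⁺) ≡ next (γ (toℕ j))
    γ⁺ = closedWalk-hom γ-walk (proj₂ (cycleSuccessor j))

    γ⁻ : γ (toℕ j⁻) ≡ prev (γ (toℕ j))
    γ⁻ = sym (trans (cong prev (closedWalk-hom γ-walk (proj₂ (cyclePredecessor j)))) (prev-next _))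

    seen : Rainbow (map f neighbours)
    seen = subst₂ (λ c⁻ c⁺ → Rainbow (_ ∷ _ ∷ tile (ρ (toℕ i)) c⁻ ∷ tile (ρ (toℕ i)) c⁺ ∷ []))
      (sym γ⁻) (sym γ⁺)
      (rainbow (ρ (toℕ i)) (γ (toℕ j)) empty
        (closedWalk-hom ρ-walk (proj₂ (cyclePredecessor i))) (closedWalk-hom ρ-walk (proj₂ (cycleSuccessor i))))

    neighbour : ∀ π → Sees π (map f neighbours) → ∃ λ u → TorusAdj m n (i , j) u × π (f u) ≡ true
    neighbour π s = Any.lookup s′ , lookupAny adjacent s′
      where s′ = map⁻ {f = f} s

∑< : ℕ → (ℕ → ℕ) → ℕ
∑< zero h = 0
∑< (suc n) h = h 0 + ∑< n (h ∘ suc)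

infix 5 ∑<
syntax ∑< n (λ a → e) = ∑[ a < n ] e

∑<-cong : ∀ n {g h : ℕ → ℕ} → (∀ a → g a ≡ h a) → ∑< n g ≡ ∑< n h
∑<-cong zero g≗h = refl
∑<-cong (suc n) g≗h = cong₂ _+_ (g≗h 0) (∑<-cong n (g≗h ∘ suc))

∑<-+ : ∀ a b (h : ℕ → ℕ) → ∑< (a + b) h ≡ ∑< a h + (∑[ x < b ] h (a + x))
∑<-+ zero b h = refl
∑<-+ (suc a) b h = trans (cong (h 0 +_) (∑<-+ a b (h ∘ suc))) (sym (+-assoc (h 0) _ _))

∑<-*ˡ : ∀ n q (h : ℕ → ℕ) → ∑[ a < n ] q * h a ≡ q * ∑< n h
∑<-*ˡ zero q h = sym (*-zeroʳ q)
∑<-*ˡ (suc n) q h = trans (cong (q * h 0 +_) (∑<-*ˡ n q (h ∘ suc))) (sym (*-distribˡ-+ q (h 0) _))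

∑<-periodic : ∀ q p (h : ℕ → ℕ) → (∀ b → h (p + b) ≡ h b) → ∑< (q * p) h ≡ q * ∑< p h
∑<-periodic zero p h periodic = refl
∑<-periodic (suc q) p h periodic = begin
  ∑< (p + q * p) h                        ≡⟨ ∑<-+ p (q * p) h ⟩
  ∑< p h + (∑[ b < q * p ] h (p + b))     ≡⟨ cong (∑< p h +_) (∑<-cong (q * p) periodic) ⟩
  ∑< p h + ∑< (q * p) h                   ≡⟨ cong (∑< p h +_) (∑<-periodic q p h periodic) ⟩
  ∑< p h + q * ∑< p h                     ∎
  where open ≡-Reasoning

sum-tabulate-toℕ : ∀ n (h : ℕ → ℕ) → sum (tabulate {n = n} (h ∘ toℕ)) ≡ ∑< n h
sum-tabulate-toℕ zero h = refl
sum-tabulate-toℕ (suc n) h = cong (h 0 +_) (sum-tabulate-toℕ n (h ∘ suc))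

sum-map-allFin : ∀ n (h : ℕ → ℕ) → sum (map (h ∘ toℕ) (allFin n)) ≡ ∑< n h
sum-map-allFin n h = trans (cong sum (map-tabulate {n = n} (λ i → i) (h ∘ toℕ))) (sum-tabulate-toℕ n h)

weight-∑ : ∀ m n (g : ℕ → ℕ → Label) →
  weight m n (λ (i , j) → g (toℕ i) (toℕ j)) ≡ ∑[ a < m ] ∑[ b < n ] ∣ g a b ∣ₗ
weight-∑ m n g = trans
  (cong sum (map-cong (λ i → sum-map-allFin n (λ b → ∣ g (toℕ i) b ∣ₗ)) (allFin m)))
  (sum-map-allFin m (λ a → ∑[ b < n ] ∣ g a b ∣ₗ))

data Row : Set where
  row₀ row₁ row₂ row₁₂ : Row

data _⟶_ : Row → Row → Set where
  0⟶1 : row₀ ⟶ row₁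
  1⟶2 : row₁ ⟶ row₂
  2⟶0 : row₂ ⟶ row₀
  0⟶12 : row₀ ⟶ row₁₂
  12⟶0 : row₁₂ ⟶ row₀

data Col : Set where
  c₀ c₁ c₂ c₃ c₄ c₅ : Col

next : Col → Col
next c₀ = c₁
next c₁ = c₂
next c₂ = c₃
next c₃ = c₄
next c₄ = c₅
next c₅ = c₀

prev : Col → Col
prev c₀ = c₅
prev c₁ = c₀
prev c₂ = c₁
prev c₃ = c₂
prev c₄ = c₃
prev c₅ = c₄

prev-next : ∀ c → prev (next c) ≡ c
prev-next c₀ = refl
prev-next c₁ = refl
prev-next c₂ = refl
prev-next c₃ = refl
prev-next c₄ = refl
prev-next c₅ = refl

one two none : Label
one = true , false
two = false , true
none = false , false

tile : Row → Col → Label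
tile row₀ c₀ = one
tile row₀ c₃ = two
tile row₁ c₂ = one
tile row₁ c₅ = two
tile row₂ c₄ = one
tile row₂ c₁ = two
tile row₁₂ c₂ = one
tile row₁₂ c₄ = one
tile row₁₂ c₁ = two
tile row₁₂ c₅ = two
tile _ _ = none

pattern above = here refl
pattern below = there (here refl)
pattern left = there (there (here refl))
pattern right = there (there (there (here refl)))

tile-locallyRainbow : LocallyRainbow _⟶_ prev next tile
tile-locallyRainbow row₀ c₀ (() , _)
tile-locallyRainbow row₀ c₁ _ 2⟶0 _ = left , above
tile-locallyRainbow row₀ c₁ _ 12⟶0 _ = left , above
tile-locallyRainbow row₀ c₂ _ _ 0⟶1 = below , right
tile-locallyRainbow row₀ c₂ _ _ 0⟶12 = below , right
tile-locallyRainbow row₀ c₃ (_ , ())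
tile-locallyRainbow row₀ c₄ _ 2⟶0 _ = above , left
tile-locallyRainbow row₀ c₄ _ 12⟶0 _ = above , left
tile-locallyRainbow row₀ c₅ _ _ 0⟶1 = right , below
tile-locallyRainbow row₀ c₅ _ _ 0⟶12 = right , below
tile-locallyRainbow row₁ c₀ _ 0⟶1 _ = above , left
tile-locallyRainbow row₁ c₁ _ _ 1⟶2 = right , below
tile-locallyRainbow row₁ c₂ (() , _)
tile-locallyRainbow row₁ c₃ _ 0⟶1 _ = left , above
tile-locallyRainbow row₁ c₄ _ _ 1⟶2 = below , right
tile-locallyRainbow row₁ c₅ (_ , ())
tile-locallyRainbow row₂ c₀ _ _ 2⟶0 = below , right
tile-locallyRainbow row₂ c₁ (_ , ())
tile-locallyRainbow row₂ c₂ _ 1⟶2 _ = above , left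
tile-locallyRainbow row₂ c₃ _ _ 2⟶0 = right , below
tile-locallyRainbow row₂ c₄ (() , _)
tile-locallyRainbow row₂ c₅ _ 1⟶2 _ = left , above
tile-locallyRainbow row₁₂ c₀ _ 0⟶12 _ = above , left
tile-locallyRainbow row₁₂ c₁ (_ , ())
tile-locallyRainbow row₁₂ c₂ (() , _)
tile-locallyRainbow row₁₂ c₃ _ 0⟶12 _ = left , above
tile-locallyRainbow row₁₂ c₄ (() , _)
tile-locallyRainbow row₁₂ c₅ (_ , ())

rowType : ℕ → ℕ → Row
rowType _ 0 = row₀
rowType zero (suc _) = row₁₂
rowType (suc k) 1 = row₁
rowType (suc k) 2 = row₂
rowType (suc k) (suc (suc (suc a))) = rowType k a

3*[1+k]+b : ∀ k b → 3 * suc k + b ≡ 3 + (3 * k + b)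
3*[1+k]+b k b = cong (_+ b) (*-suc 3 k)

rowType-step : ∀ k a → suc a < 3 * k + 2 → rowType k a ⟶ rowType k (suc a)
rowType-step zero 0 _ = 0⟶12
rowType-step zero (suc a) (s<s (s<s ()))
rowType-step (suc k) 0 _ = 0⟶1
rowType-step (suc k) 1 _ = 1⟶2
rowType-step (suc k) 2 _ = 2⟶0
rowType-step (suc k) (suc (suc (suc a))) a+4<m =
  rowType-step k a (s<s⁻¹ (s<s⁻¹ (s<s⁻¹ (subst (suc (3 + a) <_) (3*[1+k]+b k 2) a+4<m))))

rowType-last : ∀ k → rowType k (3 * k + 1) ≡ row₁₂
rowType-last zero = refl
rowType-last (suc k) = trans (cong (rowType (suc k)) (3*[1+k]+b k 1)) (rowType-last k)

rowType-closedWalk : ∀ k → ClosedWalk _⟶_ (3 * k + 2) (rowType k)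
rowType-closedWalk k = record { step = rowType-step k ; wrap = wrap }
  where
  wrap : ∀ a → suc a ≡ 3 * k + 2 → rowType k a ⟶ row₀
  wrap a a+1≡m = subst (_⟶ row₀) (sym (trans (cong (rowType k) a≡) (rowType-last k))) 12⟶0
    where
    a≡ : a ≡ 3 * k + 1
    a≡ = suc-injective (trans a+1≡m (+-suc (3 * k) 1))

colPhase : ℕ → Col
colPhase 0 = c₀
colPhase 1 = c₁
colPhase 2 = c₂
colPhase 3 = c₃
colPhase 4 = c₄
colPhase 5 = c₅
colPhase (suc (suc (suc (suc (suc (suc b)))))) = colPhase b

colPhase-suc : ∀ b → colPhase (suc b) ≡ next (colPhase b)
colPhase-suc 0 = refl
colPhase-suc 1 = refl
colPhase-suc 2 = refl
colPhase-suc 3 = refl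
colPhase-suc 4 = refl
colPhase-suc 5 = refl
colPhase-suc (suc (suc (suc (suc (suc (suc b)))))) = colPhase-suc b

colPhase-*6 : ∀ q → colPhase (q * 6) ≡ c₀
colPhase-*6 zero = refl
colPhase-*6 (suc q) = colPhase-*6 q

colPhase-closedWalk : ∀ q → ClosedWalk (λ c c' → c' ≡ next c) (q * 6) colPhase
colPhase-closedWalk q = record { step = λ b _ → colPhase-suc b ; wrap = wrap }
  where
  wrap : ∀ b → suc b ≡ q * 6 → c₀ ≡ next (colPhase b)
  wrap b b+1≡n = trans (sym (colPhase-*6 q)) (trans (cong colPhase (sym b+1≡n)) (colPhase-suc b))

torusTiling : ∀ k {n} → Fin (3 * k + 2) × Fin n → Label
torusTiling k (i , j) = tile (rowType k (toℕ i)) (colPhase (toℕ j))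

torusTiling-2RDF : ∀ k q → Is2RDF (3 * k + 2) (q * 6) (torusTiling k)
torusTiling-2RDF k q = pullback-2RDF _⟶_ prev next tile tile-locallyRainbow prev-next
  (rowType k) colPhase (rowType-closedWalk k) (colPhase-closedWalk q)

rowWeight : Row → ℕ
rowWeight r = ∑[ b < 6 ] ∣ tile r (colPhase b) ∣ₗ

∑<-rowWeight : ∀ k → ∑[ a < 3 * k + 2 ] rowWeight (rowType k a) ≡ suc k * 6
∑<-rowWeight zero = refl
∑<-rowWeight (suc k) = trans (cong (λ m → ∑[ a < m ] rowWeight (rowType (suc k) a)) (3*[1+k]+b k 2))
  (cong (6 +_) (∑<-rowWeight k))

weight-torusTiling : ∀ k q → weight (3 * k + 2) (q * 6) (torusTiling k) ≡ suc k * (q * 6)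
weight-torusTiling k q = begin
  weight m (q * 6) (torusTiling k)
    ≡⟨ weight-∑ m (q * 6) (λ a b → tile (rowType k a) (colPhase b)) ⟩
  ∑[ a < m ] ∑[ b < q * 6 ] ∣ tile (rowType k a) (colPhase b) ∣ₗ
    ≡⟨ ∑<-cong m (λ a → ∑<-periodic q 6 _ (λ _ → refl)) ⟩
  ∑[ a < m ] q * rowWeight (rowType k a)
    ≡⟨ ∑<-*ˡ m q (rowWeight ∘ rowType k) ⟩
  q * (∑[ a < m ] rowWeight (rowType k a))
    ≡⟨ cong (q *_) (∑<-rowWeight k) ⟩
  q * (suc k * 6)
    ≡⟨ x∙yz≈y∙xz q (suc k) 6 ⟩
  suc k * (q * 6)   ∎
  where
  open ≡-Reasoning
  m = 3 * k + 2

torusTiling-γr2≤ : ∀ k q → γr2≤ (3 * k + 2) (q * 6) (k * (q * 6) + q * 6)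
torusTiling-γr2≤ k q =
  torusTiling k , torusTiling-2RDF k q ,
  ≤-reflexive (trans (weight-torusTiling k q) (+-comm (q * 6) (k * (q * 6))))

proposition2 : (k n : ℕ) → 5 ≤ 3 * k + 2 → 6 ≤ n → n % 6 ≡ 0 →
    γr2≤ (3 * k + 2) n (k * n + n)
proposition2 k n _ _ n%6≡0 with m%n≡0⇒n∣m n 6 n%6≡0
... | divides q refl = torusTiling-γr2≤ k q
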